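{- If $\mathcal{H}$ is a hereditary family of graphs, then membership in $\mathcal{R}(\mathcal{H})$ can be decided by the greedy algorithm.
   Context: A family of graphs $\mathcal{H}$ is hereditary if it is closed under isomorphism and vertex removal: if $G\in\mathcal{H}$ then $G\setminus v\in\mathcal{H}$ for every vertex $v$ of $G$ (in particular it contains the empty graph if nonempty). A $2$-complex is a finite simplicial complex of dimension at most $2$. For a vertex $v$ of a $2$-complex $K$, the link $\mathrm{lk}_K(v)$ is the subcomplex of faces $\tau\in K$ with $v\notin\tau$ and $\tau\cup\{v\}\in K$ (a graph); $K\setminus v$ is the subcomplex of faces not containing $v$. A vertex $v$ is initial if $\mathrm{lk}_K(v)\in\mathcal{H}$; $K$ is $\mathcal{H}$-reducible if either $K$ is the one-point complex or $K$ has an initial vertex $v$ with $K\setminus v$ $\mathcal{H}$-reducible; $\mathcal{R}(\mathcal{H})$ is the family of $\mathcal{H}$-reducible $2$-complexes. The greedy algorithm, on input $K$, repeatedly removes an arbitrarily chosen initial vertex as long as the current complex has more than one vertex and has an initial vertex, and accepts iff it ends with the one-point complex. Membership in $\mathcal{R}(\mathcal{H})$ can be decided by the greedy algorithm if for every $2$-complex $K$ and every sequence of arbitrary choices the algorithm accepts exactly when $K\in\mathcal{R}(\mathcal{H})$. -}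

module Defs where

open import Data.Nat using (ℕ; zero; suc)
open import Data.Fin using (Fin; punchIn)
open import Data.Bool using (Bool; true; false)
open import Data.List using (List; length; lookup; filterᵇ)
open import Data.List using (allFin)
open import Data.Product using (Σ; _×_)
open import Data.Empty using (⊥)
open import Relation.Nullary using (¬_)
open import Relation.Binary.PropositionalEquality using (_≡_; refl; sym; trans)
open import Function.Bundles using (_↔_; Inverse)

record Graph (n : ℕ) : Set where
  field
    adj    : Fin n → Fin n → Bool
    adj-sym    : ∀ i j → adj i j ≡ adj j i
    adj-irrefl : ∀ i → adj i i ≡ false
open Graph public

_≅_ : ∀ {n m} → Graph n → Graph m → Set
_≅_ {n} {m} G H = Σ (Fin n ↔ Fin m) λ f →
  ∀ i j → adj H (Inverse.to f i) (Inverse.to f j) ≡ adj G i j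

_∖ᵍ_ : ∀ {n} → Graph (suc n) → Fin (suc n) → Graph n
G ∖ᵍ v = record
  { adj = λ i j → adj G (punchIn v i) (punchIn v j)
  ; adj-sym = λ i j → adj-sym G (punchIn v i) (punchIn v j)
  ; adj-irrefl = λ i → adj-irrefl G (punchIn v i) }

Family : Set₁
Family = ∀ {n} → Graph n → Set

Hereditary : Family → Set
Hereditary ℋ =
  (∀ {n m} (G : Graph n) (H : Graph m) → G ≅ H → ℋ G → ℋ H) ×
  (∀ {n} (G : Graph (suc n)) (v : Fin (suc n)) → ℋ G → ℋ (G ∖ᵍ v))

-- 2-complexes on vertex set Fin n: every vertex is a 0-face, edges
-- given by E, triangles by T (symmetric, on distinct vertices, and
-- closed under taking faces).

record Complex (n : ℕ) : Set where
  field
    E : Fin n → Fin n → Bool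
    T : Fin n → Fin n → Fin n → Bool
    E-sym    : ∀ a b → E a b ≡ E b a
    E-irrefl : ∀ a → E a a ≡ false
    T-swap₁  : ∀ a b c → T a b c ≡ T b a c
    T-swap₂  : ∀ a b c → T a b c ≡ T a c b
    T-irrefl : ∀ a b → T a a b ≡ false
    T-edge   : ∀ a b c → T a b c ≡ true → E a b ≡ true
open Complex public

_∖_ : ∀ {n} → Complex (suc n) → Fin (suc n) → Complex n
K ∖ v = record
  { E = λ a b → E K (p a) (p b)
  ; T = λ a b c → T K (p a) (p b) (p c)
  ; E-sym = λ a b → E-sym K (p a) (p b)
  ; E-irrefl = λ a → E-irrefl K (p a)
  ; T-swap₁ = λ a b c → T-swap₁ K (p a) (p b) (p c)
  ; T-swap₂ = λ a b c → T-swap₂ K (p a) (p b) (p c)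
  ; T-irrefl = λ a b → T-irrefl K (p a) (p b)
  ; T-edge = λ a b c → T-edge K (p a) (p b) (p c) }
  where p = punchIn v

nbrs : ∀ {n} → Complex n → Fin n → List (Fin n)
nbrs K v = filterᵇ (E K v) (allFin _)

link : ∀ {n} (K : Complex n) (v : Fin n) → Graph (length (nbrs K v))
link K v = record
  { adj = λ i j → T K v (ℓ i) (ℓ j)
  ; adj-sym = λ i j → T-swap₂ K v (ℓ i) (ℓ j)
  ; adj-irrefl = λ i → trans (T-swap₁ K v (ℓ i) (ℓ i))
                       (trans (T-swap₂ K (ℓ i) v (ℓ i)) (T-irrefl K (ℓ i) v)) }
  where ℓ = lookup (nbrs K v)

Initial : Family → ∀ {n} → Complex n → Fin n → Set
Initial ℋ K v = ℋ (link K v)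

data Reducible (ℋ : Family) : ∀ {n} → Complex n → Set where
  point : (K : Complex 1) → Reducible ℋ K
  step  : ∀ {n} (K : Complex (suc n)) (v : Fin (suc n)) →
          Initial ℋ K v → Reducible ℋ (K ∖ v) → Reducible ℋ K

-- GreedyRun ℋ K b : some complete run of the greedy algorithm on K
-- (with some sequence of arbitrary choices) ends with answer b
-- (true = accept).
data GreedyRun (ℋ : Family) : ∀ {n} → Complex n → Bool → Set where
  stop-empty : (K : Complex 0) → GreedyRun ℋ K false
  stop-point : (K : Complex 1) → GreedyRun ℋ K true
  stop-stuck : ∀ {n} (K : Complex (suc (suc n))) →
               (∀ v → ¬ Initial ℋ K v) → GreedyRun ℋ K false
  remove     : ∀ {n} (K : Complex (suc (suc n))) (v : Fin (suc (suc n))) {b} →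
               Initial ℋ K v → GreedyRun ℋ (K ∖ v) b → GreedyRun ℋ K b

DecidedByGreedy : Family → Set
DecidedByGreedy ℋ = ∀ {n} (K : Complex n) (b : Bool) → GreedyRun ℋ K b →
  (b ≡ true → Reducible ℋ K) × (Reducible ℋ K → b ≡ true)

-- Everything rests on an exchange property: if K is reducible and v is initial in K, then
-- K ∖ v is reducible, so the greedy algorithm can never get stuck on a reducible complex.
-- A reduction of K starts by removing some initial w ≠ v.  Removing v from K leaves w
-- initial, since lk(w) either loses the vertex v or is unchanged and ℋ is hereditary;
-- symmetrically v stays initial in K ∖ w.  By induction (K ∖ w) ∖ v is reducible, and it is
-- the same complex as (K ∖ v) ∖ w, so removing w first reduces K ∖ v.
--
-- Since vertex removal re-indexes vertices, "the same complex" is made precise by viewing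
-- complexes (and links) as induced substructures of an ambient one, via an injective
-- labelling that enumerates their vertex set: two such with the same vertex set have
-- isomorphic links and are reducible together.

module Submission where

open import Defs

open import Level using (0ℓ)
open import Data.Nat using (ℕ; zero; suc)
open import Data.Fin using (Fin; zero; suc; punchIn; punchOut; _≟_)
open import Data.Fin.Properties using (punchIn-injective; punchInᵢ≢i; punchIn-punchOut)
open import Data.Bool as Bool using (Bool; true)
open import Data.Bool.Properties using (T-≡)
open import Data.List using (List; _∷_; length; lookup; filterᵇ; allFin)
open import Data.List.Relation.Unary.All as All using ()
open import Data.List.Relation.Unary.Any using (index)
open import Data.List.Relation.Unary.Any.Properties using (lookup-index)
open import Data.List.Relation.Unary.AllPairs using (_∷_)
open import Data.List.Relation.Unary.Unique.Propositional using (Unique)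
open import Data.List.Relation.Unary.Unique.Propositional.Properties using (allFin⁺; filter⁺)
open import Data.List.Membership.Propositional.Properties using (∈-filter⁺; ∈-filter⁻; ∈-lookup; ∈-allFin)
open import Data.Product using (Σ; Σ-syntax; ∃; _,_; proj₁; proj₂)
open import Data.Empty using (⊥-elim)
open import Function using (id; _∘_)
open import Function.Bundles using (_↔_; Inverse; mk↔ₛ′; Equivalence)
open import Relation.Nullary using (¬_; yes; no)
open import Relation.Unary using (Pred; U; _∩_; _⊆_; _≐_)
open import Relation.Binary.PropositionalEquality

lookup-injective : ∀ {A : Set} {xs : List A} → Unique xs →
                   ∀ {i j} → lookup xs i ≡ lookup xs j → i ≡ j
lookup-injective (_ ∷ _)   {zero}  {zero}  _  = refl
lookup-injective (x∉ ∷ _)  {zero}  {suc j} eq = ⊥-elim (All.lookup x∉ (∈-lookup j) eq)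
lookup-injective (x∉ ∷ _)  {suc i} {zero}  eq = ⊥-elim (All.lookup x∉ (∈-lookup i) (sym eq))
lookup-injective (_ ∷ xs!) {suc i} {suc j} eq = cong suc (lookup-injective xs! eq)

record Enumerates {A : Set} {k : ℕ} (e : Fin k → A) (P : Pred A 0ℓ) : Set where
  field
    injective : ∀ {a b} → e a ≡ e b → a ≡ b
    sound     : ∀ a → P (e a)
    complete  : ∀ {x} → P x → ∃ λ a → e a ≡ x
open Enumerates

module _ {A : Set} where

  enumerates-≐ : ∀ {k} {e : Fin k → A} {P Q : Pred A 0ℓ} →
                 P ≐ Q → Enumerates e P → Enumerates e Q
  enumerates-≐ (P⊆Q , Q⊆P) en = record
    { injective = injective en
    ; sound     = P⊆Q ∘ sound en
    ; complete  = complete en ∘ Q⊆P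
    }

  enumerates-punchIn : ∀ {k} {e : Fin (suc k) → A} {P : Pred A 0ℓ} {v x} →
                       Enumerates e P → e v ≡ x → Enumerates (e ∘ punchIn v) (P ∩ (_≢ x))
  enumerates-punchIn {e = e} {v = v} en refl = record
    { injective = punchIn-injective v _ _ ∘ injective en
    ; sound     = λ a → sound en _ , punchInᵢ≢i v a ∘ injective en
    ; complete  = λ (Py , y≢ev) →
        let (a , ea≡y) = complete en Py
            v≢a = λ v≡a → y≢ev (trans (sym ea≡y) (cong e (sym v≡a)))
        in punchOut v≢a , trans (cong e (punchIn-punchOut v≢a)) ea≡y
    }

  enumerates-filter : ∀ {n} {e : Fin n → A} {P : Pred A 0ℓ} (β : Fin n → Bool) (γ : A → Bool) →
                      (∀ a → β a ≡ γ (e a)) → Enumerates e P →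
                      Enumerates (e ∘ lookup (filterᵇ β (allFin n))) (P ∩ λ x → γ x ≡ true)
  enumerates-filter {n} {e} β γ β≡γ∘e en = record
    { injective = lookup-injective (filter⁺ _ (allFin⁺ n)) ∘ injective en
    ; sound     = λ c → sound en _ , trans (sym (β≡γ∘e _)) (selected c)
    ; complete  = λ {x} (Px , γx) →
        let (a , ea≡x) = complete en Px
            a∈ = ∈-filter⁺ _ (∈-allFin a)
                   (Equivalence.from T-≡ (trans (β≡γ∘e a) (subst (λ y → γ y ≡ true) (sym ea≡x) γx)))
        in index a∈ , trans (cong e (sym (lookup-index a∈))) ea≡x
    }
    where
    selected : ∀ c → β (lookup (filterᵇ β (allFin n)) c) ≡ true
    selected c = Equivalence.to T-≡ (proj₂ (∈-filter⁻ _ {xs = allFin n} (∈-lookup c)))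

  enumerates-↔ : ∀ {k m} {e : Fin k → A} {f : Fin m → A} {P : Pred A 0ℓ} →
                 Enumerates e P → Enumerates f P →
                 Σ[ σ ∈ Fin k ↔ Fin m ] ∀ a → f (Inverse.to σ a) ≡ e a
  enumerates-↔ {k} {m} {e} {f} ee ef = mk↔ₛ′ to from to∘from from∘to , proj₂ ∘ match
    where
    match : ∀ a → ∃ λ b → f b ≡ e a
    match a = complete ef (sound ee a)
    match⁻ : ∀ b → ∃ λ a → e a ≡ f b
    match⁻ b = complete ee (sound ef b)
    to : Fin k → Fin m
    to = proj₁ ∘ match
    from : Fin m → Fin k
    from = proj₁ ∘ match⁻
    to∘from : ∀ b → to (from b) ≡ b
    to∘from b = injective ef (trans (proj₂ (match (from b))) (proj₂ (match⁻ b)))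
    from∘to : ∀ a → from (to a) ≡ a
    from∘to a = injective ee (trans (proj₂ (match⁻ (to a))) (proj₂ (match a)))

record InducedSubgraph {A : Set} (α : A → A → Bool) (P : Pred A 0ℓ) {k : ℕ} (G : Graph k) : Set where
  field
    label      : Fin k → A
    enumerates : Enumerates label P
    adj-label  : ∀ a b → adj G a b ≡ α (label a) (label b)
open InducedSubgraph

module _ {A : Set} {α : A → A → Bool} where

  inducedSubgraph-≐ : ∀ {k} {G : Graph k} {P Q : Pred A 0ℓ} →
                      P ≐ Q → InducedSubgraph α P G → InducedSubgraph α Q G
  inducedSubgraph-≐ P≐Q S = record
    { label = label S ; enumerates = enumerates-≐ P≐Q (enumerates S) ; adj-label = adj-label S }

  inducedSubgraph-∖ᵍ : ∀ {k} {G : Graph (suc k)} {P : Pred A 0ℓ} {v x} →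
                       (S : InducedSubgraph α P G) → label S v ≡ x →
                       InducedSubgraph α (P ∩ (_≢ x)) (G ∖ᵍ v)
  inducedSubgraph-∖ᵍ {v = v} S v↦x = record
    { label      = label S ∘ punchIn v
    ; enumerates = enumerates-punchIn (enumerates S) v↦x
    ; adj-label  = λ a b → adj-label S (punchIn v a) (punchIn v b)
    }

  inducedSubgraph-≅ : ∀ {k m} {G : Graph k} {H : Graph m} {P : Pred A 0ℓ} →
                      InducedSubgraph α P G → InducedSubgraph α P H → G ≅ H
  inducedSubgraph-≅ {G = G} {H} SG SH = σ , adj-preserved
    where
    open Σ (enumerates-↔ (enumerates SG) (enumerates SH)) renaming (proj₁ to σ; proj₂ to σ-label)
    open Inverse σ using (to)
    adj-preserved : ∀ a b → adj H (to a) (to b) ≡ adj G a b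
    adj-preserved a b = begin
      adj H (to a) (to b)                     ≡⟨ adj-label SH (to a) (to b) ⟩
      α (label SH (to a)) (label SH (to b))   ≡⟨ cong₂ α (σ-label a) (σ-label b) ⟩
      α (label SG a) (label SG b)             ≡⟨ sym (adj-label SG a b) ⟩
      adj G a b                               ∎
      where open ≡-Reasoning

Neighbour : ∀ {N} → Complex N → Fin N → Pred (Fin N) 0ℓ
Neighbour K x y = E K x y ≡ true

record InducedSubcomplex {N : ℕ} (K : Complex N) (P : Pred (Fin N) 0ℓ) {n : ℕ} (L : Complex n) : Set where
  field
    label      : Fin n → Fin N
    enumerates : Enumerates label P
    E-label    : ∀ a b → E L a b ≡ E K (label a) (label b)
    T-label    : ∀ a b c → T L a b c ≡ T K (label a) (label b) (label c)
open InducedSubcomplex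

module _ {N : ℕ} {K : Complex N} where

  inducedSubcomplex-refl : InducedSubcomplex K U K
  inducedSubcomplex-refl = record
    { label      = id
    ; enumerates = record { injective = id ; sound = _ ; complete = λ {x} _ → x , refl }
    ; E-label    = λ _ _ → refl
    ; T-label    = λ _ _ _ → refl
    }

  inducedSubcomplex-≐ : ∀ {n} {L : Complex n} {P Q : Pred (Fin N) 0ℓ} →
                        P ≐ Q → InducedSubcomplex K P L → InducedSubcomplex K Q L
  inducedSubcomplex-≐ P≐Q S = record
    { label = label S ; enumerates = enumerates-≐ P≐Q (enumerates S)
    ; E-label = E-label S ; T-label = T-label S }

  inducedSubcomplex-∖ : ∀ {n} {L : Complex (suc n)} {P : Pred (Fin N) 0ℓ} {v x} →
                        (S : InducedSubcomplex K P L) → label S v ≡ x →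
                        InducedSubcomplex K (P ∩ (_≢ x)) (L ∖ v)
  inducedSubcomplex-∖ {v = v} S v↦x = record
    { label      = label S ∘ punchIn v
    ; enumerates = enumerates-punchIn (enumerates S) v↦x
    ; E-label    = λ a b → E-label S (punchIn v a) (punchIn v b)
    ; T-label    = λ a b c → T-label S (punchIn v a) (punchIn v b) (punchIn v c)
    }

  link-induced : ∀ {n} {L : Complex n} {P : Pred (Fin N) 0ℓ} {v x} →
                 (S : InducedSubcomplex K P L) → label S v ≡ x →
                 InducedSubgraph (T K x) (P ∩ Neighbour K x) (link L v)
  link-induced {n} {L} {v = v} S refl = record
    { label      = label S ∘ ℓ
    ; enumerates = enumerates-filter (E L v) (E K (label S v)) (E-label S v) (enumerates S)
    ; adj-label  = λ i j → T-label S v (ℓ i) (ℓ j)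
    }
    where
    ℓ : Fin (length (nbrs L v)) → Fin n
    ℓ = lookup (nbrs L v)

∩-swapʳ : ∀ {A : Set} (P Q R : Pred A 0ℓ) → (P ∩ Q) ∩ R ≐ (P ∩ R) ∩ Q
∩-swapʳ _ _ _ = (λ ((p , q) , r) → (p , r) , q) , (λ ((p , r) , q) → (p , q) , r)

∖-induced : ∀ {n} {K : Complex (suc n)} {v} → InducedSubcomplex K (U ∩ (_≢ v)) (K ∖ v)
∖-induced {K = K} {v} = inducedSubcomplex-∖ {v = v} (inducedSubcomplex-refl {K = K}) refl

∖-∖-induced : ∀ {n} {K : Complex (suc (suc n))} {v w} (v≢w : v ≢ w) →
              InducedSubcomplex K ((U ∩ (_≢ v)) ∩ (_≢ w)) ((K ∖ v) ∖ punchOut v≢w)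
∖-∖-induced {K = K} {v} v≢w = inducedSubcomplex-∖ {v = punchOut v≢w} (∖-induced {K = K}) (punchIn-punchOut v≢w)

link-induced-self : ∀ {n} {K : Complex n} {w} → InducedSubgraph (T K w) (U ∩ Neighbour K w) (link K w)
link-induced-self {K = K} = link-induced (inducedSubcomplex-refl {K = K}) refl

link-∖-induced : ∀ {n} {K : Complex (suc (suc n))} {v w} (v≢w : v ≢ w) →
                 InducedSubgraph (T K w) ((U ∩ Neighbour K w) ∩ (_≢ v)) (link (K ∖ v) (punchOut v≢w))
link-∖-induced {K = K} {v} {w} v≢w =
  inducedSubgraph-≐ (∩-swapʳ U (_≢ v) (Neighbour K w)) (link-induced (∖-induced {K = K}) (punchIn-punchOut v≢w))

link-∖-nonadjacent : ∀ {n} {K : Complex (suc (suc n))} {v w} (v≢w : v ≢ w) → ¬ Neighbour K w v →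
                     link K w ≅ link (K ∖ v) (punchOut v≢w)
link-∖-nonadjacent {K = K} {v} {w} v≢w v∉lk =
  inducedSubgraph-≅ (inducedSubgraph-≐ (add-≢v , proj₁) (link-induced-self {K = K})) (link-∖-induced {K = K} v≢w)
  where
  add-≢v : U ∩ Neighbour K w ⊆ (U ∩ Neighbour K w) ∩ (_≢ v)
  add-≢v (_ , wy) = (_ , wy) , λ { refl → v∉lk wy }

module _ {ℋ : Family} (hereditary : Hereditary ℋ) where
  open Σ hereditary renaming (proj₁ to ≅-closed; proj₂ to ∖ᵍ-closed)

  induced-∖ᵍ-closed : ∀ {A : Set} {α : A → A → Bool} {P : Pred A 0ℓ} {k m} {G : Graph k} {H : Graph m} {x y} →
                      (S : InducedSubgraph α P G) → label S x ≡ y → InducedSubgraph α (P ∩ (_≢ y)) H →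
                      ℋ G → ℋ H
  induced-∖ᵍ-closed {k = suc _} {x = x} S x↦y S' =
    ≅-closed _ _ (inducedSubgraph-≅ (inducedSubgraph-∖ᵍ S x↦y) S') ∘ ∖ᵍ-closed _ x

  initial-induced : ∀ {N n} {K : Complex N} {P : Pred (Fin N) 0ℓ} {L L' : Complex n} {v v'} →
                    (S : InducedSubcomplex K P L) (S' : InducedSubcomplex K P L') →
                    label S v ≡ label S' v' → Initial ℋ L v → Initial ℋ L' v'
  initial-induced S S' v≈v' =
    ≅-closed _ _ (inducedSubgraph-≅ (link-induced S refl) (link-induced S' (sym v≈v')))

  reducible-induced : ∀ {N n} {K : Complex N} {P : Pred (Fin N) 0ℓ} {L L' : Complex n} →
                      InducedSubcomplex K P L → InducedSubcomplex K P L' →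
                      Reducible ℋ L → Reducible ℋ L'
  reducible-induced S S' (point _) = point _
  reducible-induced S S' (step _ v I r) =
    let (v' , v'↦) = complete (enumerates S') (sound (enumerates S) v)
    in step _ v' (initial-induced S S' (sym v'↦) I)
         (reducible-induced (inducedSubcomplex-∖ S refl) (inducedSubcomplex-∖ S' v'↦) r)

  initial-∖ : ∀ {n} {K : Complex (suc (suc n))} {v w} (v≢w : v ≢ w) →
              Initial ℋ K w → Initial ℋ (K ∖ v) (punchOut v≢w)
  initial-∖ {K = K} {v} {w} v≢w I with E K w v Bool.≟ true
  ... | yes wv =
    let (x , x↦v) = complete (enumerates (link-induced-self {K = K} {w})) (_ , wv)
    in induced-∖ᵍ-closed (link-induced-self {K = K} {w}) x↦v (link-∖-induced {K = K} v≢w) I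
  ... | no ¬wv = ≅-closed _ _ (link-∖-nonadjacent {K = K} v≢w ¬wv) I

  reducible-∖-initial : ∀ {n} {K : Complex (suc (suc n))} → Reducible ℋ K →
                        ∀ v → Initial ℋ K v → Reducible ℋ (K ∖ v)
  reducible-∖-initial (step _ w Iw r) v Iv with v ≟ w
  ... | yes refl = r
  reducible-∖-initial {zero}  (step K w Iw r) v Iv | no v≢w = point (K ∖ v)
  reducible-∖-initial {suc n} (step K w Iw r) v Iv | no v≢w =
    step (K ∖ v) (punchOut v≢w) (initial-∖ {K = K} v≢w Iw)
      (reducible-induced (∖-∖-induced {K = K} w≢v)
        (inducedSubcomplex-≐ (∩-swapʳ U (_≢ v) (_≢ w)) (∖-∖-induced {K = K} v≢w))
        (reducible-∖-initial r (punchOut w≢v) (initial-∖ {K = K} w≢v Iv)))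
    where
    w≢v : w ≢ v
    w≢v = v≢w ∘ sym

  greedy-sound : ∀ {n} {K : Complex n} {b} → GreedyRun ℋ K b → b ≡ true → Reducible ℋ K
  greedy-sound (stop-point K)       _        = point K
  greedy-sound (remove K v I run) accepted = step K v I (greedy-sound run accepted)

  greedy-complete : ∀ {n} {K : Complex n} {b} → GreedyRun ℋ K b → Reducible ℋ K → b ≡ true
  greedy-complete (stop-point _)        _               = refl
  greedy-complete (stop-stuck _ stuck)  (step _ v I _)  = ⊥-elim (stuck v I)
  greedy-complete (remove K v I run)    r               = greedy-complete run (reducible-∖-initial r v I)

proposition1p6 : (ℋ : Family) → Hereditary ℋ → DecidedByGreedy ℋ
proposition1p6 ℋ hereditary K b run = greedy-sound hereditary run , greedy-complete hereditary run
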